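{- $\mathbb{P}(L_3)$ does not satisfy inclusion: there exists $\Gamma\subseteq For$ with $\Gamma\not\subseteq Cn^{\mathbb{P}}_{L_3}(\Gamma)$.
   Context: $For$ is the set of formulas built from a countable set $Prop$ of propositional letters with $\neg,\vee,\wedge,\rightarrow$. $L_3$ (Łukasiewicz) is given by the matrix with truth values $\{0,1/2,1\}$, designated set $\{1\}$, $f_\neg(x)=1-x$, $f_\vee=\max$, $f_\wedge=\min$, $f_\rightarrow(x,y)=\min\{1,1-x+y\}$; valuations are maps $Prop\to\{0,1/2,1\}$ extended via these functions. $\Gamma\vDash_{L_3}\alpha$ iff every valuation giving all members of $\Gamma$ value $1$ gives $\alpha$ value $1$; $Cn_{L_3}(\Gamma)=\{\alpha:\Gamma\vDash_{L_3}\alpha\}$; $\Gamma$ is $L_3$-consistent iff $Cn_{L_3}(\Gamma)\neq For$. $\Gamma\vDash^{\mathbb{P}}_{L_3}\alpha$ iff there exists an $L_3$-consistent $\Gamma'\subseteq\Gamma$ with $\Gamma'\vDash_{L_3}\alpha$; $Cn^{\mathbb{P}}_{L_3}(\Gamma)=\{\alpha:\Gamma\vDash^{\mathbb{P}}_{L_3}\alpha\}$. -}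

module Defs where

open import Data.Nat using (ℕ)
open import Data.Product using (Σ; _×_)
open import Relation.Binary.PropositionalEquality using (_≡_)
open import Relation.Nullary using (¬_)

Prop : Set
Prop = ℕ

data For : Set where
  var  : Prop → For
  ¬'_  : For → For
  _∨'_ : For → For → For
  _∧'_ : For → For → For
  _⇒'_ : For → For → For

-- Truth values {0, 1/2, 1}.
data V3 : Set where
  v0 vh v1 : V3

-- f¬(x) = 1 - x
f¬ : V3 → V3
f¬ v0 = v1
f¬ vh = vh
f¬ v1 = v0

-- f∨ = max
f∨ : V3 → V3 → V3
f∨ v0 y = y
f∨ vh v0 = vh
f∨ vh vh = vh
f∨ vh v1 = v1
f∨ v1 y = v1

-- f∧ = min
f∧ : V3 → V3 → V3
f∧ v0 y = v0
f∧ vh v0 = v0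
f∧ vh vh = vh
f∧ vh v1 = vh
f∧ v1 y = y

-- f→(x,y) = min{1, 1 - x + y}
f⇒ : V3 → V3 → V3
f⇒ v0 y  = v1
f⇒ vh v0 = vh
f⇒ vh vh = v1
f⇒ vh v1 = v1
f⇒ v1 y  = y

Valuation : Set
Valuation = Prop → V3

eval : Valuation → For → V3
eval v (var p)   = v p
eval v (¬' a)    = f¬ (eval v a)
eval v (a ∨' b)  = f∨ (eval v a) (eval v b)
eval v (a ∧' b)  = f∧ (eval v a) (eval v b)
eval v (a ⇒' b)  = f⇒ (eval v a) (eval v b)

FSet : Set₁
FSet = For → Set

_⊆_ : FSet → FSet → Set
Γ ⊆ Δ = ∀ α → Γ α → Δ α

_⊨L3_ : FSet → For → Set
Γ ⊨L3 α = ∀ (v : Valuation) → (∀ γ → Γ γ → eval v γ ≡ v1) → eval v α ≡ v1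

CnL3 : FSet → FSet
CnL3 Γ α = Γ ⊨L3 α

Consistent : FSet → Set
Consistent Γ = ¬ (∀ α → CnL3 Γ α)

_⊨P_ : FSet → For → Set₁
Γ ⊨P α = Σ FSet (λ Γ' → (Γ' ⊆ Γ) × (Consistent Γ' × (Γ' ⊨L3 α)))

CnP : FSet → For → Set₁
CnP Γ α = Γ ⊨P α

module Submission where

-- In L₃ a contradiction α ∧ ¬α always takes value min(x, 1 − x) ≤ 1/2, so it is
-- never designated. Any set entailing it therefore entails everything, so no
-- consistent subset can witness it, and Γ = {p ∧ ¬p} fails to P-entail its own
-- member.

open import Defs
open import Data.Product using (Σ; _,_)
open import Relation.Nullary using (¬_)
open import Relation.Binary.PropositionalEquality using (_≡_; _≢_; refl)
open import Data.Empty using (⊥-elim)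

Unsatisfiable : For → Set
Unsatisfiable α = ∀ v → eval v α ≢ v1

f∧-f¬-undesignated : ∀ x → f∧ x (f¬ x) ≢ v1
f∧-f¬-undesignated v0 ()
f∧-f¬-undesignated vh ()
f∧-f¬-undesignated v1 ()

contradiction-unsatisfiable : ∀ α → Unsatisfiable (α ∧' (¬' α))
contradiction-unsatisfiable α v = f∧-f¬-undesignated (eval v α)

⊨L3-unsatisfiable⇒inconsistent : ∀ {Γ} α → Unsatisfiable α → Γ ⊨L3 α → ¬ Consistent Γ
⊨L3-unsatisfiable⇒inconsistent _ unsat Γ⊨α consistent =
  consistent (λ β v Γ-designated → ⊥-elim (unsat v (Γ⊨α v Γ-designated)))

unsatisfiable∉CnP : ∀ {Γ} α → Unsatisfiable α → ¬ CnP Γ α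
unsatisfiable∉CnP α unsat (Γ' , _ , consistent , Γ'⊨α) =
  ⊨L3-unsatisfiable⇒inconsistent α unsat Γ'⊨α consistent

proposition7 : Σ FSet (λ Γ → ¬ (∀ α → Γ α → CnP Γ α))
proposition7 = (_≡ p∧¬p) , λ inclusion →
  unsatisfiable∉CnP p∧¬p (contradiction-unsatisfiable (var 0)) (inclusion p∧¬p refl)
  where
  p∧¬p : For
  p∧¬p = var 0 ∧' (¬' var 0)
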